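{- Let $\mathbf U=\langle\langle U,\approx\rangle,\preceq\rangle$ be an $\mathbf L$-ordered set and let $V_1,V_2\in L^U$ be two $\mathbf L$-sets having minimum and maximum, with $\min V_1=u_1$, $\max V_1=v_1$, $\min V_2=u_2$, $\max V_2=v_2$. Then $V_1\preceq^{+}V_2=(u_1\preceq u_2)\wedge(v_1\preceq v_2)$.
   Context: $\mathbf L=\langle L,\wedge,\vee,\otimes,\to,0,1\rangle$ is a complete residuated lattice ($\langle L,\wedge,\vee,0,1\rangle$ complete lattice, $\langle L,\otimes,1\rangle$ commutative monoid, $a\otimes b\le c$ iff $a\le b\to c$). An $\mathbf L$-set in $X$ is a map $X\to L$; $L^X$ the set of them; $S(A,B)=\bigwedge_x(A(x)\to B(x))$. An $\mathbf L$-equality is a binary $\mathbf L$-relation that is reflexive, symmetric, transitive ($R(x,y)\otimes R(y,z)\le R(x,z)$) and with $R(x,y)=1\Rightarrow x=y$. An $\mathbf L$-ordered set is $\langle\langle U,\approx\rangle,\preceq\rangle$, $\approx$ an $\mathbf L$-equality, $\preceq$ reflexive, transitive, compatible with $\approx$ ($(u\preceq v)\otimes(u\approx u')\otimes(v\approx v')\le(u'\preceq v')$), and $(u\preceq v)\wedge(v\preceq u)\le u\approx v$. For $V\in L^U$: $\mathcal L V(v)=\bigwedge_u(V(u)\to(v\preceq u))$, $\mathcal U V(v)=\bigwedge_u(V(u)\to(u\preceq v))$; $\inf V$ is the unique $u$ (if it exists) with $\mathcal L V(u)=1=\mathcal U(\mathcal L V)(u)$, $\sup V$ the unique $u$ with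 $\mathcal U V(u)=1=\mathcal L(\mathcal U V)(u)$. If $\inf V$ exists and $V(\inf V)=1$ it is called the minimum $\min V$; if $\sup V$ exists and $V(\sup V)=1$ it is the maximum $\max V$. Power relation: for $R$ on $X$, $A,B\in L^X$, $(R\circ B)(x)=\bigvee_y R(x,y)\otimes B(y)$, $(A\circ R)(y)=\bigvee_x A(x)\otimes R(x,y)$, $R^+(A,B)=S(A,R\circ B)\wedge S(B,A\circ R)$. -}

module Defs where

open import Level using (Level; suc; _⊔_) renaming (zero to lzero)
open import Relation.Binary.PropositionalEquality using (_≡_)
open import Data.Product using (_×_)

record CompleteResiduatedLattice : Set₁ where
  infixr 5 _⇒_
  infixl 7 _⊗_
  infixl 6 _∧_
  infixl 5 _∨_
  infix 4 _≤_
  field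
    Carrier : Set
    _≤_     : Carrier → Carrier → Set
    ≤-refl  : ∀ {a} → a ≤ a
    ≤-trans : ∀ {a b c} → a ≤ b → b ≤ c → a ≤ c
    ≤-antisym : ∀ {a b} → a ≤ b → b ≤ a → a ≡ b
    _∧_ _∨_ : Carrier → Carrier → Carrier
    𝟘 𝟙     : Carrier
    ∧-lb₁ : ∀ a b → a ∧ b ≤ a
    ∧-lb₂ : ∀ a b → a ∧ b ≤ b
    ∧-glb : ∀ {a b c} → c ≤ a → c ≤ b → c ≤ a ∧ b
    ∨-ub₁ : ∀ a b → a ≤ a ∨ b
    ∨-ub₂ : ∀ a b → b ≤ a ∨ b
    ∨-lub : ∀ {a b c} → a ≤ c → b ≤ c → a ∨ b ≤ c
    𝟘-min : ∀ a → 𝟘 ≤ a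
    𝟙-max : ∀ a → a ≤ 𝟙
    ⋀ : {I : Set} → (I → Carrier) → Carrier
    ⋁ : {I : Set} → (I → Carrier) → Carrier
    ⋀-lb  : ∀ {I} (f : I → Carrier) (i : I) → ⋀ f ≤ f i
    ⋀-glb : ∀ {I} (f : I → Carrier) {a} → (∀ i → a ≤ f i) → a ≤ ⋀ f
    ⋁-ub  : ∀ {I} (f : I → Carrier) (i : I) → f i ≤ ⋁ f
    ⋁-lub : ∀ {I} (f : I → Carrier) {a} → (∀ i → f i ≤ a) → ⋁ f ≤ a
    _⊗_ : Carrier → Carrier → Carrier
    ⊗-comm  : ∀ a b → a ⊗ b ≡ b ⊗ a
    ⊗-assoc : ∀ a b c → (a ⊗ b) ⊗ c ≡ a ⊗ (b ⊗ c)
    ⊗-identityʳ : ∀ a → a ⊗ 𝟙 ≡ a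
    _⇒_ : Carrier → Carrier → Carrier
    adj→ : ∀ {a b c} → a ⊗ b ≤ c → a ≤ b ⇒ c
    adj← : ∀ {a b c} → a ≤ b ⇒ c → a ⊗ b ≤ c

module _ (𝐋 : CompleteResiduatedLattice) where
  open CompleteResiduatedLattice 𝐋 renaming (Carrier to L)

  record IsLEquality {X : Set} (_≈_ : X → X → L) : Set where
    field
      refl  : ∀ x → (x ≈ x) ≡ 𝟙
      sym   : ∀ x y → (x ≈ y) ≡ (y ≈ x)
      trans : ∀ x y z → (x ≈ y) ⊗ (y ≈ z) ≤ (x ≈ z)
      sep   : ∀ x y → (x ≈ y) ≡ 𝟙 → x ≡ y

  record LOrderedSet : Set₁ where
    field
      U   : Set
      _≈_ : U → U → L
      _⪯_ : U → U → L
      isLEquality : IsLEquality _≈_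
      ⪯-refl   : ∀ u → (u ⪯ u) ≡ 𝟙
      ⪯-trans  : ∀ u v w → (u ⪯ v) ⊗ (v ⪯ w) ≤ (u ⪯ w)
      ⪯-compat : ∀ u v u' v' → (u ⪯ v) ⊗ (u ≈ u') ⊗ (v ≈ v') ≤ (u' ⪯ v')
      ⪯-antisym : ∀ u v → (u ⪯ v) ∧ (v ⪯ u) ≤ (u ≈ v)

  S : {X : Set} → (X → L) → (X → L) → L
  S A B = ⋀ (λ x → A x ⇒ B x)

  _∘ᵣ_ : {X : Set} → (X → X → L) → (X → L) → X → L
  (R ∘ᵣ B) x = ⋁ (λ y → R x y ⊗ B y)

  _ᵣ∘_ : {X : Set} → (X → L) → (X → X → L) → X → L
  (A ᵣ∘ R) y = ⋁ (λ x → A x ⊗ R x y)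

  _⁺ : {X : Set} → (X → X → L) → (X → L) → (X → L) → L
  (R ⁺) A B = S A (R ∘ᵣ B) ∧ S B (A ᵣ∘ R)

  module _ (𝐔 : LOrderedSet) where
    open LOrderedSet 𝐔

    𝓛 : (U → L) → U → L
    𝓛 V v = ⋀ (λ u → V u ⇒ (v ⪯ u))

    𝓤 : (U → L) → U → L
    𝓤 V v = ⋀ (λ u → V u ⇒ (u ⪯ v))

    -- u is the infimum / supremum of V (uniqueness is automatic by
    -- antisymmetry and separation of ≈)
    IsInf : (U → L) → U → Set
    IsInf V u = (𝓛 V u ≡ 𝟙) × (𝓤 (𝓛 V) u ≡ 𝟙)

    IsSup : (U → L) → U → Set
    IsSup V u = (𝓤 V u ≡ 𝟙) × (𝓛 (𝓤 V) u ≡ 𝟙)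

    IsMin : (U → L) → U → Set
    IsMin V u = IsInf V u × (V u ≡ 𝟙)

    IsMax : (U → L) → U → Set
    IsMax V u = IsSup V u × (V u ≡ 𝟙)

-- The two halves of V₁ ⪯⁺ V₂ separate.  Evaluating S(V₁, ⪯ ∘ V₂) at v₁ (where V₁ is 1) bounds it
-- by v₁ ⪯ v₂, because every y with V₂ y > 0 lies below v₂; conversely every x in V₁ lies below v₁
-- and v₂ witnesses v₁ ⪯ v₂ in ⪯ ∘ V₂.  Dually S(V₂, V₁ ∘ ⪯) = u₁ ⪯ u₂ via the least elements.
module Submission where

open import Defs
open import Relation.Binary.PropositionalEquality using (_≡_; refl; sym; trans; subst; cong₂)
open import Data.Product using (_×_; _,_)

module ResiduatedLatticeProperties (𝐋 : CompleteResiduatedLattice) where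
  open CompleteResiduatedLattice 𝐋 renaming (Carrier to L)

  ≡⇒≤ : ∀ {a b} → a ≡ b → a ≤ b
  ≡⇒≤ refl = ≤-refl

  ∧-comm : ∀ a b → a ∧ b ≡ b ∧ a
  ∧-comm a b = ≤-antisym (∧-glb (∧-lb₂ a b) (∧-lb₁ a b)) (∧-glb (∧-lb₂ b a) (∧-lb₁ b a))

  ⊗-identityˡ : ∀ a → 𝟙 ⊗ a ≡ a
  ⊗-identityˡ a = subst (_≡ a) (⊗-comm a 𝟙) (⊗-identityʳ a)

  ⊗-monoˡ : ∀ {a b} c → a ≤ b → a ⊗ c ≤ b ⊗ c
  ⊗-monoˡ c a≤b = adj← (≤-trans a≤b (adj→ ≤-refl))

  ⊗-monoʳ : ∀ {a b} c → a ≤ b → c ⊗ a ≤ c ⊗ b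
  ⊗-monoʳ {a} {b} c a≤b =
    subst (_≤ c ⊗ b) (⊗-comm a c) (subst (a ⊗ c ≤_) (⊗-comm b c) (⊗-monoˡ c a≤b))

  ⊗-mono : ∀ {a b c d} → a ≤ b → c ≤ d → a ⊗ c ≤ b ⊗ d
  ⊗-mono {b = b} {c = c} a≤b c≤d = ≤-trans (⊗-monoˡ c a≤b) (⊗-monoʳ b c≤d)

  module _ {X : Set} where

    S-intro : ∀ {c} {A B : X → L} → (∀ x → c ⊗ A x ≤ B x) → c ≤ S 𝐋 A B
    S-intro c⊗A≤B = ⋀-glb _ λ x → adj→ (c⊗A≤B x)

    S-elim : ∀ {A B : X → L} x → S 𝐋 A B ⊗ A x ≤ B x
    S-elim {A} {B} x = adj← (⋀-lb (λ y → A y ⇒ B y) x)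

    S-elim-𝟙 : ∀ {A B : X → L} x → A x ≡ 𝟙 → S 𝐋 A B ≤ B x
    S-elim-𝟙 {A} {B} x Ax≡𝟙 =
      subst (_≤ B x) (⊗-identityʳ _) (subst (λ a → S 𝐋 A B ⊗ a ≤ B x) Ax≡𝟙 (S-elim x))

    S≡𝟙⇒⊆ : ∀ {A B : X → L} → S 𝐋 A B ≡ 𝟙 → ∀ x → A x ≤ B x
    S≡𝟙⇒⊆ {A} {B} S≡𝟙 x =
      subst (_≤ B x) (⊗-identityˡ (A x)) (subst (λ s → s ⊗ A x ≤ B x) S≡𝟙 (S-elim x))

    ∘ᵣ-≥ : ∀ (R : X → X → L) {B : X → L} x y → B y ≡ 𝟙 → R x y ≤ _∘ᵣ_ 𝐋 R B x
    ∘ᵣ-≥ R {B} x y By≡𝟙 =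
      subst (λ b → b ≤ _∘ᵣ_ 𝐋 R B x)
            (subst (λ a → R x y ⊗ a ≡ R x y) (sym By≡𝟙) (⊗-identityʳ (R x y)))
            (⋁-ub (λ z → R x z ⊗ B z) y)

    ᵣ∘-≥ : ∀ {A : X → L} (R : X → X → L) x y → A x ≡ 𝟙 → R x y ≤ _ᵣ∘_ 𝐋 A R y
    ᵣ∘-≥ {A} R x y Ax≡𝟙 =
      subst (λ b → b ≤ _ᵣ∘_ 𝐋 A R y)
            (subst (λ a → a ⊗ R x y ≡ R x y) (sym Ax≡𝟙) (⊗-identityˡ (R x y)))
            (⋁-ub (λ z → A z ⊗ R z y) x)

module LOrderedSetProperties (𝐋 : CompleteResiduatedLattice) (𝐔 : LOrderedSet 𝐋) where
  open CompleteResiduatedLattice 𝐋 renaming (Carrier to L)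
  open LOrderedSet 𝐔
  open ResiduatedLatticeProperties 𝐋

  IsGreatest : (U → L) → U → Set
  IsGreatest V v = (𝓤 𝐋 𝐔 V v ≡ 𝟙) × (V v ≡ 𝟙)

  IsLeast : (U → L) → U → Set
  IsLeast V u = (𝓛 𝐋 𝐔 V u ≡ 𝟙) × (V u ≡ 𝟙)

  IsMax⇒IsGreatest : ∀ {V v} → IsMax 𝐋 𝐔 V v → IsGreatest V v
  IsMax⇒IsGreatest ((upper , _) , Vv≡𝟙) = upper , Vv≡𝟙

  IsMin⇒IsLeast : ∀ {V u} → IsMin 𝐋 𝐔 V u → IsLeast V u
  IsMin⇒IsLeast ((lower , _) , Vu≡𝟙) = lower , Vu≡𝟙

  ⊗-⪯-trans : ∀ {a b u v w} → a ≤ (u ⪯ v) → b ≤ (v ⪯ w) → a ⊗ b ≤ (u ⪯ w)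
  ⊗-⪯-trans {u = u} {v} {w} a≤ b≤ = ≤-trans (⊗-mono a≤ b≤) (⪯-trans u v w)

  S-⪯∘ᵣ-greatest : ∀ {V₁ V₂ v₁ v₂} → IsGreatest V₁ v₁ → IsGreatest V₂ v₂ →
                   S 𝐋 V₁ (_∘ᵣ_ 𝐋 _⪯_ V₂) ≡ (v₁ ⪯ v₂)
  S-⪯∘ᵣ-greatest {V₁} {V₂} {v₁} {v₂} (v₁-upper , V₁v₁≡𝟙) (v₂-upper , V₂v₂≡𝟙) =
    ≤-antisym
      (≤-trans (S-elim-𝟙 v₁ V₁v₁≡𝟙)
               (⋁-lub _ λ y → ⊗-⪯-trans ≤-refl (S≡𝟙⇒⊆ v₂-upper y)))
      (S-intro λ x →
        ≤-trans (≡⇒≤ (⊗-comm _ (V₁ x)))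
                (≤-trans (⊗-⪯-trans (S≡𝟙⇒⊆ v₁-upper x) ≤-refl) (∘ᵣ-≥ _⪯_ x v₂ V₂v₂≡𝟙)))

  S-ᵣ∘⪯-least : ∀ {V₁ V₂ u₁ u₂} → IsLeast V₁ u₁ → IsLeast V₂ u₂ →
                S 𝐋 V₂ (_ᵣ∘_ 𝐋 V₁ _⪯_) ≡ (u₁ ⪯ u₂)
  S-ᵣ∘⪯-least {V₁} {V₂} {u₁} {u₂} (u₁-lower , V₁u₁≡𝟙) (u₂-lower , V₂u₂≡𝟙) =
    ≤-antisym
      (≤-trans (S-elim-𝟙 u₂ V₂u₂≡𝟙)
               (⋁-lub _ λ x → ⊗-⪯-trans (S≡𝟙⇒⊆ u₁-lower x) ≤-refl))
      (S-intro λ y →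
        ≤-trans (⊗-⪯-trans ≤-refl (S≡𝟙⇒⊆ u₂-lower y)) (ᵣ∘-≥ _⪯_ u₁ y V₁u₁≡𝟙))

lemma14 : (𝐋 : CompleteResiduatedLattice) (𝐔 : LOrderedSet 𝐋)
          (V₁ V₂ : LOrderedSet.U 𝐔 → CompleteResiduatedLattice.Carrier 𝐋)
          (u₁ v₁ u₂ v₂ : LOrderedSet.U 𝐔) →
          IsMin 𝐋 𝐔 V₁ u₁ → IsMax 𝐋 𝐔 V₁ v₁ →
          IsMin 𝐋 𝐔 V₂ u₂ → IsMax 𝐋 𝐔 V₂ v₂ →
          _⁺ 𝐋 (LOrderedSet._⪯_ 𝐔) V₁ V₂
            ≡ CompleteResiduatedLattice._∧_ 𝐋 (LOrderedSet._⪯_ 𝐔 u₁ u₂) (LOrderedSet._⪯_ 𝐔 v₁ v₂)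
lemma14 𝐋 𝐔 V₁ V₂ u₁ v₁ u₂ v₂ min₁ max₁ min₂ max₂ =
  trans (cong₂ _∧_ (S-⪯∘ᵣ-greatest (IsMax⇒IsGreatest max₁) (IsMax⇒IsGreatest max₂))
                   (S-ᵣ∘⪯-least (IsMin⇒IsLeast min₁) (IsMin⇒IsLeast min₂)))
        (∧-comm _ _)
  where
  open CompleteResiduatedLattice 𝐋 using (_∧_)
  open ResiduatedLatticeProperties 𝐋 using (∧-comm)
  open LOrderedSetProperties 𝐋 𝐔
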